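{- Let $G=(U\cup W,E)$ be a non-trivial circular graph. Then: (i) $d(u_1,u_2)=2$ for any distinct $u_1,u_2\in U$; (ii) $d(w_1,w_2)=2$ or $d(w_1,w_2)=4$ for any distinct $w_1,w_2\in W$; (iii) $d(u_1,w_1)\in\{1,3\}$ for any $u_1\in U$ and $w_1\in W$. Here $d(\cdot,\cdot)$ denotes the distance in $G$.
   Context: All graphs are finite and simple. For vertices $v_1,\dots,v_k$, $cn(v_1,\dots,v_k)$ denotes the number of common neighbours of $v_1,\dots,v_k$. A circular graph is a finite bipartite graph $G$ with a specified bipartition $V(G)=U\cup W$ into nonempty sets ($U\cap W=\emptyset$, every edge joins $U$ to $W$) such that (i) $cn(u_i,u_j,u_k)=1$ for all distinct $u_i,u_j,u_k\in U$, and (ii) $d(w)\ge 3$ for every $w\in W$. It is trivial if $|U|=1$ or $|W|=1$, and non-trivial otherwise. -}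

module Defs where

open import Data.Nat using (ℕ; zero; suc; _+_; _≤_)
open import Data.Fin using (Fin; zero; suc)
open import Data.Bool using (Bool; true; false; T; _∧_)
open import Data.Sum using (_⊎_; inj₁; inj₂)
open import Data.Product using (_×_)
open import Data.Empty using (⊥)
open import Relation.Binary.PropositionalEquality using (_≡_; _≢_)

countF : {n : ℕ} → (Fin n → Bool) → ℕ
countF {zero} p = 0
countF {suc n} p with p zero
... | true  = suc (countF (λ i → p (suc i)))
... | false = countF (λ i → p (suc i))

-- A finite simple bipartite graph with bipartition U = Fin m, W = Fin n,
-- given by its biadjacency relation E : U → W → Bool.
-- Vertex set U ∪ W (disjoint union).
Vertex : ℕ → ℕ → Set
Vertex m n = Fin m ⊎ Fin n

Adj : {m n : ℕ} → (Fin m → Fin n → Bool) → Vertex m n → Vertex m n → Set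
Adj E (inj₁ u) (inj₂ w) = T (E u w)
Adj E (inj₂ w) (inj₁ u) = T (E u w)
Adj E (inj₁ _) (inj₁ _) = ⊥
Adj E (inj₂ _) (inj₂ _) = ⊥

cn3 : {m n : ℕ} → (Fin m → Fin n → Bool) → Fin m → Fin m → Fin m → ℕ
cn3 E i j k = countF (λ w → E i w ∧ E j w ∧ E k w)

degW : {m n : ℕ} → (Fin m → Fin n → Bool) → Fin n → ℕ
degW E w = countF (λ u → E u w)

record IsCircular (m n : ℕ) (E : Fin m → Fin n → Bool) : Set where
  field
    U-nonempty : 1 ≤ m
    W-nonempty : 1 ≤ n
    common : ∀ i j k → i ≢ j → j ≢ k → i ≢ k → cn3 E i j k ≡ 1
    degree : ∀ w → 3 ≤ degW E w

data Walk {m n : ℕ} (E : Fin m → Fin n → Bool) : Vertex m n → Vertex m n → ℕ → Set where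
  nil  : ∀ {x} → Walk E x x 0
  cons : ∀ {x y z k} → Adj E x y → Walk E y z k → Walk E x z (suc k)

Dist : {m n : ℕ} → (Fin m → Fin n → Bool) → Vertex m n → Vertex m n → ℕ → Set
Dist E x y k = Walk E x y k × (∀ j → Walk E x y j → k ≤ j)

{-# OPTIONS --safe #-}
module Submission where

open import Defs
open import Data.Nat using (ℕ; zero; suc; _≤_; _<_; z≤n; s≤s)
open import Data.Nat.Properties using (≤-trans; ≤-refl; n≤1+n; ≮⇒≥)
open import Data.Fin using (Fin; zero; suc; fromℕ<)
open import Data.Fin.Properties using (_≟_; any?)
open import Data.Bool using (Bool; true; false; T; _∧_; not)
open import Data.Bool.Properties using (T-∧)
open import Data.Sum using (_⊎_; inj₁; inj₂)
open import Data.Product using (_×_; _,_; ∃; proj₁)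
open import Function.Bundles using (Equivalence)
open import Relation.Nullary using (¬_; yes; no; does)
open import Relation.Nullary.Decidable using (T?; _×-dec_)
open import Relation.Binary.PropositionalEquality using (_≢_; refl; sym; subst)

-- Two vertices u₁ ≠ u₂ of U have a common neighbour: any w ∈ W has a third
-- neighbour u₃, and cn(u₁, u₂, u₃) = 1.  This gives (i) at once; for (iii), a
-- non-neighbour u of w reaches w as u – w' – u' – w through a neighbour u' ≠ u
-- of w, and for (ii), w₁ and w₂ without a common neighbour are joined as
-- w₁ – u₁ – w' – u₂ – w₂ through distinct neighbours u₁ of w₁ and u₂ of w₂.
-- The matching lower bounds hold because the graph is bipartite.

private
  variable
    m n j k : ℕ

countF-witness : (p : Fin n → Bool) → 1 ≤ countF p → ∃ λ i → T (p i)
countF-witness {suc n} p 1≤count with p zero in eq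
... | true  = zero , subst T (sym eq) _
... | false with countF-witness (λ i → p (suc i)) 1≤count
...   | i , pi = suc i , pi

except : Fin n → (Fin n → Bool) → Fin n → Bool
except j p i = not (does (i ≟ j)) ∧ p i

T-except : (j : Fin n) (p : Fin n → Bool) (i : Fin n) → T (except j p i) → i ≢ j × T (p i)
T-except j p i t with i ≟ j
... | no i≢j = i≢j , t

countF≤suc-countF-except : (j : Fin n) (p : Fin n → Bool) → countF p ≤ suc (countF (except j p))
countF≤suc-countF-except {suc n} zero p with p zero
... | true  = ≤-refl
... | false = n≤1+n _
countF≤suc-countF-except {suc n} (suc j) p with p zero
... | true  = s≤s (countF≤suc-countF-except j (λ i → p (suc i)))
... | false = countF≤suc-countF-except j (λ i → p (suc i))

countF-except-≥ : (j : Fin n) (p : Fin n → Bool) → suc k ≤ countF p → k ≤ countF (except j p)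
countF-except-≥ j p k<count with ≤-trans k<count (countF≤suc-countF-except j p)
... | s≤s k≤count = k≤count

countF-witness-≢ : (p : Fin n → Bool) → 2 ≤ countF p → (j : Fin n) → ∃ λ i → i ≢ j × T (p i)
countF-witness-≢ p 2≤count j =
  let i , t = countF-witness (except j p) (countF-except-≥ j p 2≤count)
  in  i , T-except j p i t

countF-witness-≢₂ : (p : Fin n → Bool) → 3 ≤ countF p → (j k : Fin n) →
  ∃ λ i → i ≢ j × i ≢ k × T (p i)
countF-witness-≢₂ p 3≤count j k =
  let i , i≢k , t = countF-witness-≢ (except j p) (countF-except-≥ j p 3≤count) k
      i≢j , pi    = T-except j p i t
  in  i , i≢j , i≢k , pi

dist-intro : {E : Fin m → Fin n → Bool} {x y : Vertex m n} →
  Walk E x y k → (∀ {j} → j < k → ¬ Walk E x y j) → Dist E x y k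
dist-intro walk no-shorter = walk , λ j walk′ → ≮⇒≥ (λ j<k → no-shorter j<k walk′)

module _ {E : Fin m → Fin n → Bool} where

  no-short-walk-U-U : {u₁ u₂ : Fin m} → u₁ ≢ u₂ → j < 2 → ¬ Walk E (inj₁ u₁) (inj₁ u₂) j
  no-short-walk-U-U u₁≢u₂ (s≤s z≤n)       nil          = u₁≢u₂ refl
  no-short-walk-U-U _     (s≤s (s≤s z≤n)) (cons () nil)

  no-short-walk-U-W : {u : Fin m} {w : Fin n} → ¬ T (E u w) → j < 3 →
    ¬ Walk E (inj₁ u) (inj₂ w) j
  no-short-walk-U-W ¬uw (s≤s (s≤s z≤n))       (cons uw nil)                   = ¬uw uw
  no-short-walk-U-W _   (s≤s (s≤s (s≤s z≤n))) (cons {y = inj₁ _} () _)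
  no-short-walk-U-W _   (s≤s (s≤s (s≤s z≤n))) (cons {y = inj₂ _} _ (cons () nil))

  no-short-walk-W-W : {w₁ w₂ : Fin n} → w₁ ≢ w₂ →
    ¬ (∃ λ u → T (E u w₁) × T (E u w₂)) → j < 4 → ¬ Walk E (inj₂ w₁) (inj₂ w₂) j
  no-short-walk-W-W w₁≢w₂ _ (s≤s z≤n) nil = w₁≢w₂ refl
  no-short-walk-W-W _ _ (s≤s (s≤s z≤n)) (cons () nil)
  no-short-walk-W-W _ ¬common (s≤s (s≤s (s≤s z≤n))) (cons {y = inj₁ u} uw₁ (cons uw₂ nil)) =
    ¬common (u , uw₁ , uw₂)
  no-short-walk-W-W _ _ (s≤s (s≤s (s≤s (s≤s z≤n)))) (cons {y = inj₂ _} () _)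
  no-short-walk-W-W _ _ (s≤s (s≤s (s≤s (s≤s z≤n)))) (cons {y = inj₁ _} _ (cons {y = inj₁ _} () _))
  no-short-walk-W-W _ _ (s≤s (s≤s (s≤s (s≤s z≤n))))
    (cons {y = inj₁ _} _ (cons {y = inj₂ _} _ (cons () nil)))

module _ {E : Fin m → Fin n → Bool} (circular : IsCircular m n E) where
  open IsCircular circular

  common-neighbour : {u₁ u₂ : Fin m} → u₁ ≢ u₂ → ∃ λ w → T (E u₁ w) × T (E u₂ w)
  common-neighbour {u₁} {u₂} u₁≢u₂ =
    let w = fromℕ< W-nonempty
        u₃ , u₃≢u₁ , u₃≢u₂ , _ = countF-witness-≢₂ (λ u → E u w) (degree w) u₁ u₂
        cn≡1 = common u₁ u₂ u₃ u₁≢u₂ (λ u₂≡u₃ → u₃≢u₂ (sym u₂≡u₃)) (λ u₁≡u₃ → u₃≢u₁ (sym u₁≡u₃))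
        w′ , t = countF-witness (λ w → E u₁ w ∧ E u₂ w ∧ E u₃ w) (subst (1 ≤_) (sym cn≡1) ≤-refl)
        u₁w′ , u₂u₃w′ = Equivalence.to T-∧ t
    in  w′ , u₁w′ , proj₁ (Equivalence.to T-∧ u₂u₃w′)

  dist-U-U : (u₁ u₂ : Fin m) → u₁ ≢ u₂ → Dist E (inj₁ u₁) (inj₁ u₂) 2
  dist-U-U u₁ u₂ u₁≢u₂ =
    let w , u₁w , u₂w = common-neighbour u₁≢u₂
    in  dist-intro (cons {y = inj₂ w} u₁w (cons u₂w nil)) (no-short-walk-U-U u₁≢u₂)

  dist-U-W : (u : Fin m) (w : Fin n) → Dist E (inj₁ u) (inj₂ w) 1 ⊎ Dist E (inj₁ u) (inj₂ w) 3
  dist-U-W u w with T? (E u w)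
  ... | yes uw = inj₁ (dist-intro (cons uw nil) λ { (s≤s z≤n) () })
  ... | no ¬uw =
    let u′ , u′≢u , u′w = countF-witness-≢ (λ v → E v w) (≤-trans (s≤s (s≤s z≤n)) (degree w)) u
        w′ , uw′ , u′w′ = common-neighbour (λ u≡u′ → u′≢u (sym u≡u′))
    in  inj₂ (dist-intro (cons {y = inj₂ w′} uw′ (cons {y = inj₁ u′} u′w′ (cons u′w nil)))
                         (no-short-walk-U-W ¬uw))

  dist-W-W : (w₁ w₂ : Fin n) → w₁ ≢ w₂ → Dist E (inj₂ w₁) (inj₂ w₂) 2 ⊎ Dist E (inj₂ w₁) (inj₂ w₂) 4
  dist-W-W w₁ w₂ w₁≢w₂ with any? (λ u → T? (E u w₁) ×-dec T? (E u w₂))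
  ... | yes (u , uw₁ , uw₂) = inj₁ (dist-intro (cons {y = inj₁ u} uw₁ (cons uw₂ nil)) λ
    { (s≤s z≤n) nil → w₁≢w₂ refl ; (s≤s (s≤s z≤n)) (cons () nil) })
  ... | no ¬common =
    let u₁ , u₁w₁       = countF-witness (λ v → E v w₁) (≤-trans (s≤s z≤n) (degree w₁))
        u₂ , u₂≢u₁ , u₂w₂ = countF-witness-≢ (λ v → E v w₂) (≤-trans (s≤s (s≤s z≤n)) (degree w₂)) u₁
        w′ , u₁w′ , u₂w′  = common-neighbour (λ u₁≡u₂ → u₂≢u₁ (sym u₁≡u₂))
    in  inj₂ (dist-intro
          (cons {y = inj₁ u₁} u₁w₁ (cons {y = inj₂ w′} u₁w′ (cons {y = inj₁ u₂} u₂w′ (cons u₂w₂ nil))))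
          (no-short-walk-W-W w₁≢w₂ ¬common))

theorem2p6 : (m n : ℕ) (E : Fin m → Fin n → Bool) → IsCircular m n E → 2 ≤ m → 2 ≤ n →
    ((u₁ u₂ : Fin m) → u₁ ≢ u₂ → Dist E (inj₁ u₁) (inj₁ u₂) 2)
    × ((w₁ w₂ : Fin n) → w₁ ≢ w₂ → Dist E (inj₂ w₁) (inj₂ w₂) 2 ⊎ Dist E (inj₂ w₁) (inj₂ w₂) 4)
    × ((u : Fin m) (w : Fin n) → Dist E (inj₁ u) (inj₂ w) 1 ⊎ Dist E (inj₁ u) (inj₂ w) 3)
theorem2p6 m n E circular _ _ = dist-U-U circular , dist-W-W circular , dist-U-W circular
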